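{- Let $\mathcal{E},\mathcal{F},\mathcal{Q}$ be nonzero vector bundles on the Fargues–Fontaine curve $X$ such that: (i) $\mathrm{rk}(\mathcal{E}^{\leq\mu})\geq\mathrm{rk}(\mathcal{F}^{\leq\mu})$ for every $\mu\in\mathbb{Q}$; (ii) $\mathrm{rk}(\mathcal{E}^{\leq\mu})\geq\mathrm{rk}(\mathcal{Q}^{\leq\mu})$ for every $\mu$, with equality only when $\mathcal{E}^{\leq\mu}\simeq\mathcal{Q}^{\leq\mu}$; (iii) $\mathrm{rk}(\mathcal{F}^{\geq\mu})\geq\mathrm{rk}(\mathcal{Q}^{\geq\mu})$ for every $\mu$; (iv) all HN slopes of $\mathcal{E},\mathcal{F},\mathcal{Q}$ are integers; (v) $\mathrm{rk}(\mathcal{Q})=\mathrm{rk}(\mathcal{F})$. Let $\overline{\mathcal{F}}$ be the maximal slope reduction of $\mathcal{F}$ to $\mathcal{Q}$. Then $\mathcal{E},\overline{\mathcal{F}},\mathcal{Q}$ also satisfy (i)–(v) (with $\overline{\mathcal{F}}$ in place of $\mathcal{F}$).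
   Context: $X$ is the Fargues–Fontaine curve attached to a finite extension $E/\mathbb{Q}_p$ and an algebraically closed perfectoid field $F$ of characteristic $p$. Every vector bundle $\mathcal{V}$ has a unique HN decomposition $\mathcal{V}\simeq\bigoplus_i\mathcal{O}(\lambda_i)^{\oplus m_i}$ with distinct rational $\lambda_i$ ($\mathcal{O}(\lambda)$ the stable bundle of slope $\lambda$); $\mu_{\max}$ is the largest HN slope; $\mathcal{V}^{\geq\mu},\mathcal{V}^{>\mu},\mathcal{V}^{\leq\mu}$ are the direct sums of the $\mathcal{O}(\lambda_i)^{\oplus m_i}$ with $\lambda_i\geq\mu$, $>\mu$, $\leq\mu$ respectively. Definition (maximal slope reduction): if $\mathcal{V},\mathcal{W}$ are nonzero with integer HN slopes and $\mathrm{rk}(\mathcal{V}^{\geq\mu})\geq\mathrm{rk}(\mathcal{W}^{\geq\mu})$ for all $\mu$, the maximal slope reduction of $\mathcal{V}$ to $\mathcal{W}$ is $\overline{\mathcal{V}}:=\mathcal{O}(\mu_{\max}(\mathcal{W}))^{\oplus\mathrm{rk}(\mathcal{V}^{>\mu_{\max}(\mathcal{W})})}\oplus\mathcal{V}^{\leq\mu_{\max}(\mathcal{W})}$. -}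

module Defs where

open import Data.Nat using (ℕ; _≥_)
open import Data.Rational using (ℚ; _⊔_; 0ℚ)
open ℚ using (denominatorℕ)
open import Data.Rational.Properties using (_≤?_; _<?_)
open import Data.List using (List; []; _∷_; map; filter; replicate; _++_)
open import Data.Nat.ListAction using (sum)
open import Data.List.Relation.Unary.All using (All)
open import Data.List.Relation.Binary.Permutation.Propositional using (_↭_)
open import Data.Product using (_×_)
open import Relation.Binary.PropositionalEquality using (_≡_)

-- A vector bundle on X up to isomorphism, via its HN decomposition
-- V ≅ ⊕ O(λ): the list of slopes of its stable summands (with repetition).
-- Isomorphism of bundles = equality of these multisets = permutation.
Bundle : Set
Bundle = List ℚ

_≃V_ : Bundle → Bundle → Set
V ≃V W = V ↭ W

-- rank of the stable bundle O(d/r) (d/r in lowest terms) is r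
rkStable : ℚ → ℕ
rkStable s = denominatorℕ s

rk : Bundle → ℕ
rk V = sum (map rkStable V)

le : ℚ → Bundle → Bundle
le μ V = filter (λ s → s ≤? μ) V

ge : ℚ → Bundle → Bundle
ge μ V = filter (λ s → μ ≤? s) V

gt : ℚ → Bundle → Bundle
gt μ V = filter (λ s → μ <? s) V

IsIntegral : ℚ → Set
IsIntegral s = denominatorℕ s ≡ 1

IntegerSlopes : Bundle → Set
IntegerSlopes V = All IsIntegral V

-- μ_max (only meaningful for nonzero bundles; value on [] irrelevant)
μmax : Bundle → ℚ
μmax [] = 0ℚ
μmax (x ∷ xs) = go x xs
  where
  go : ℚ → List ℚ → ℚ
  go m [] = m
  go m (y ∷ ys) = go (m ⊔ y) ys

reduction : Bundle → Bundle → Bundle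
reduction V W = replicate (rk (gt m V)) m ++ le m V
  where
  m = μmax W

Conditions : Bundle → Bundle → Bundle → Set
Conditions E F Q =
    (∀ μ → rk (le μ E) ≥ rk (le μ F))
  × (∀ μ → rk (le μ E) ≥ rk (le μ Q) × (rk (le μ E) ≡ rk (le μ Q) → le μ E ≃V le μ Q))
  × (∀ μ → rk (ge μ F) ≥ rk (ge μ Q))
  × (IntegerSlopes E × IntegerSlopes F × IntegerSlopes Q)
  × (rk Q ≡ rk F)

{-# OPTIONS --safe #-}
-- Put m := μmax Q; it is an integer, being a slope of Q. The reduction F̄ replaces the summands
-- of F of slope > m by copies of O(m) of the same total rank, so rk F̄ = rk F, F̄^{≤μ} = F^{≤μ}
-- for μ < m, and rk F̄^{≥μ} = rk F^{≥μ} for μ ≤ m. The remaining values of μ are covered by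
-- Q^{≤μ} = Q for μ ≥ m (so rk F̄^{≤μ} ≤ rk F̄ = rk Q ≤ rk E^{≤μ}) and Q^{≥μ} = 0 for μ > m.
-- Condition (ii) does not involve F.
module Submission where

open import Level using (Level)
open import Function using (_∘_)
open import Data.Bool using (true; false)
open import Data.Product using (_,_; proj₁)
open import Data.Sum using (inj₁; inj₂)
open import Data.Nat as ℕ using (zero; suc; _+_; z≤n)
import Data.Nat.Properties as ℕ
open import Data.Nat.ListAction using (sum)
open import Data.Nat.ListAction.Properties using (sum-++)
open import Algebra.Properties.CommutativeSemigroup ℕ.+-commutativeSemigroup using (x∙yz≈y∙xz)
open import Data.Rational as ℚ using (ℚ; _⊔_)
import Data.Rational.Properties as ℚ
open import Data.List using ([]; _∷_; map; filter; replicate; _++_)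
open import Data.List.Properties
  using (map-++; filter-++; filter-reject; filter-all; filter-none; filter-≐)
open import Data.List.Membership.Propositional using (_∈_)
open import Data.List.Relation.Unary.Any using (here; there)
open import Data.List.Relation.Unary.All as All using (All; []; _∷_)
import Data.List.Relation.Unary.All.Properties as All
open import Relation.Nullary using (yes; no; ¬_; ¬?; does; contradiction)
open import Relation.Unary using (Pred; Decidable; _⊆_)
open import Relation.Binary.PropositionalEquality
  using (_≡_; _≢_; refl; sym; trans; cong; cong₂; module ≡-Reasoning)

open import Defs

private
  variable
    a p q : Level
    A : Set a

module _ {P : Pred A p} {Q : Pred A q} (P? : Decidable P) (Q? : Decidable Q) where

  filter-comm : ∀ xs → filter P? (filter Q? xs) ≡ filter Q? (filter P? xs)
  filter-comm [] = refl
  filter-comm (x ∷ xs) with does (P? x) in eqP | does (Q? x) in eqQ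
  ... | true  | true  rewrite eqP | eqQ = cong (x ∷_) (filter-comm xs)
  ... | true  | false rewrite eqQ = filter-comm xs
  ... | false | true  rewrite eqP = filter-comm xs
  ... | false | false = filter-comm xs

  filter-filter-⊆ : P ⊆ Q → ∀ xs → filter P? (filter Q? xs) ≡ filter P? xs
  filter-filter-⊆ P⊆Q [] = refl
  filter-filter-⊆ P⊆Q (x ∷ xs) with Q? x
  ... | no ¬qx = trans (filter-filter-⊆ P⊆Q xs) (sym (filter-reject P? (¬qx ∘ P⊆Q)))
  ... | yes _ with P? x
  ...   | yes _ = cong (x ∷_) (filter-filter-⊆ P⊆Q xs)
  ...   | no  _ = filter-filter-⊆ P⊆Q xs

rk-++ : ∀ V W → rk (V ++ W) ≡ rk V + rk W
rk-++ V W = trans (cong sum (map-++ rkStable V W)) (sum-++ (map rkStable V) (map rkStable W))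

rk-replicate : ∀ k {s} → IsIntegral s → rk (replicate k s) ≡ k
rk-replicate zero    _     = refl
rk-replicate (suc k) s-int = cong₂ _+_ s-int (rk-replicate k s-int)

module _ {P : Pred ℚ p} (P? : Decidable P) where

  rk-filter-≤ : ∀ V → rk (filter P? V) ℕ.≤ rk V
  rk-filter-≤ [] = z≤n
  rk-filter-≤ (s ∷ V) with P? s
  ... | yes _ = ℕ.+-monoʳ-≤ (rkStable s) (rk-filter-≤ V)
  ... | no  _ = ℕ.≤-trans (rk-filter-≤ V) (ℕ.m≤n+m (rk V) (rkStable s))

  rk-filter+rk-filter-∁ : ∀ V → rk (filter P? V) + rk (filter (¬? ∘ P?) V) ≡ rk V
  rk-filter+rk-filter-∁ [] = refl
  rk-filter+rk-filter-∁ (s ∷ V) with P? s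
  ... | yes _ = trans (ℕ.+-assoc (rkStable s) _ _) (cong (rkStable s +_) (rk-filter+rk-filter-∁ V))
  ... | no  _ = trans (x∙yz≈y∙xz _ (rkStable s) _) (cong (rkStable s +_) (rk-filter+rk-filter-∁ V))

<⇒≱ : ∀ {p q : ℚ} → p ℚ.< q → ¬ q ℚ.≤ p
<⇒≱ p<q q≤p = ℚ.<-irrefl refl (ℚ.<-≤-trans p<q q≤p)

rk-gt+rk-le : ∀ m V → rk (gt m V) + rk (le m V) ≡ rk V
rk-gt+rk-le m V = begin
  rk (gt m V) + rk (le m V)       ≡⟨ cong (λ U → rk U + rk (le m V)) gt≡filter-≰ ⟩
  rk (filter ≰m? V) + rk (le m V) ≡⟨ ℕ.+-comm _ (rk (le m V)) ⟩
  rk (le m V) + rk (filter ≰m? V) ≡⟨ rk-filter+rk-filter-∁ (λ s → s ℚ.≤? m) V ⟩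
  rk V                            ∎
  where
  open ≡-Reasoning
  ≰m? = ¬? ∘ (λ s → s ℚ.≤? m)
  gt≡filter-≰ : gt m V ≡ filter ≰m? V
  gt≡filter-≰ = filter-≐ (λ s → m ℚ.<? s) ≰m? (<⇒≱ , ℚ.≰⇒>) V

μmax-∷-∈ : ∀ x W → μmax (x ∷ W) ∈ x ∷ W
μmax-∷-∈ x []      = here refl
μmax-∷-∈ x (y ∷ W) with μmax-∷-∈ (x ⊔ y) W
... | there m∈W = there (there m∈W)
... | here m≡x⊔y with ℚ.⊔-sel x y
...   | inj₁ x⊔y≡x = here (trans m≡x⊔y x⊔y≡x)
...   | inj₂ x⊔y≡y = there (here (trans m≡x⊔y x⊔y≡y))

μmax-∈ : ∀ W → W ≢ [] → μmax W ∈ W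
μmax-∈ []      W≢[] = contradiction refl W≢[]
μmax-∈ (x ∷ W) _    = μmax-∷-∈ x W

μmax-∷-upper : ∀ x W → All (ℚ._≤ μmax (x ∷ W)) (x ∷ W)
μmax-∷-upper x []      = ℚ.≤-refl ∷ []
μmax-∷-upper x (y ∷ W) with μmax-∷-upper (x ⊔ y) W
... | x⊔y≤m ∷ W≤m = ℚ.≤-trans (ℚ.p≤p⊔q x y) x⊔y≤m ∷ ℚ.≤-trans (ℚ.p≤q⊔p x y) x⊔y≤m ∷ W≤m

μmax-upper : ∀ W → All (ℚ._≤ μmax W) W
μmax-upper []      = []
μmax-upper (x ∷ W) = μmax-∷-upper x W

le-μmax : ∀ W {μ} → μmax W ℚ.≤ μ → le μ W ≡ W
le-μmax W m≤μ = filter-all (λ s → s ℚ.≤? _) (All.map (λ s≤m → ℚ.≤-trans s≤m m≤μ) (μmax-upper W))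

ge-μmax : ∀ W {μ} → μmax W ℚ.< μ → ge μ W ≡ []
ge-μmax W m<μ = filter-none (λ s → _ ℚ.≤? s) (All.map (λ s≤m → <⇒≱ (ℚ.≤-<-trans s≤m m<μ)) (μmax-upper W))

module _ (V W : Bundle) where

  private
    m = μmax W
    k = rk (gt m V)

  rk-reduction : IsIntegral m → rk (reduction V W) ≡ rk V
  rk-reduction m-int = begin
    rk (replicate k m ++ le m V)        ≡⟨ rk-++ (replicate k m) (le m V) ⟩
    rk (replicate k m) + rk (le m V)    ≡⟨ cong (_+ rk (le m V)) (rk-replicate k m-int) ⟩
    rk (gt m V) + rk (le m V)           ≡⟨ rk-gt+rk-le m V ⟩
    rk V                                ∎
    where open ≡-Reasoning

  IntegerSlopes-reduction : IsIntegral m → IntegerSlopes V → IntegerSlopes (reduction V W)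
  IntegerSlopes-reduction m-int V-int =
    All.++⁺ (All.replicate⁺ k m-int) (All.filter⁺ (λ s → s ℚ.≤? m) V-int)

  le-reduction : ∀ {μ} → μ ℚ.< m → le μ (reduction V W) ≡ le μ V
  le-reduction {μ} μ<m = begin
    le μ (replicate k m ++ le m V)          ≡⟨ filter-++ (λ s → s ℚ.≤? μ) (replicate k m) (le m V) ⟩
    le μ (replicate k m) ++ le μ (le m V)   ≡⟨ cong₂ _++_ reduced-part-vanishes le-le ⟩
    le μ V                                  ∎
    where
    open ≡-Reasoning
    reduced-part-vanishes : le μ (replicate k m) ≡ []
    reduced-part-vanishes = filter-none (λ s → s ℚ.≤? μ) (All.replicate⁺ k (<⇒≱ μ<m))
    le-le : le μ (le m V) ≡ le μ V
    le-le = filter-filter-⊆ (λ s → s ℚ.≤? μ) (λ s → s ℚ.≤? m)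
              (λ s≤μ → ℚ.≤-trans s≤μ (ℚ.<⇒≤ μ<m)) V

  rk-ge-reduction : IsIntegral m → ∀ {μ} → μ ℚ.≤ m → rk (ge μ (reduction V W)) ≡ rk (ge μ V)
  rk-ge-reduction m-int {μ} μ≤m = begin
    rk (ge μ (replicate k m ++ le m V))                ≡⟨ cong rk (filter-++ (λ s → μ ℚ.≤? s) (replicate k m) (le m V)) ⟩
    rk (ge μ (replicate k m) ++ ge μ (le m V))         ≡⟨ cong (λ U → rk (U ++ ge μ (le m V))) reduced-part-kept ⟩
    rk (replicate k m ++ ge μ (le m V))                ≡⟨ rk-++ (replicate k m) (ge μ (le m V)) ⟩
    rk (replicate k m) + rk (ge μ (le m V))            ≡⟨ cong₂ _+_ (rk-replicate k m-int) (cong rk ge-le≡le-ge) ⟩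
    rk (gt m V) + rk (le m (ge μ V))                   ≡⟨ cong (λ U → rk U + rk (le m (ge μ V))) gt-ge≡gt ⟨
    rk (gt m (ge μ V)) + rk (le m (ge μ V))            ≡⟨ rk-gt+rk-le m (ge μ V) ⟩
    rk (ge μ V)                                        ∎
    where
    open ≡-Reasoning
    reduced-part-kept : ge μ (replicate k m) ≡ replicate k m
    reduced-part-kept = filter-all (λ s → μ ℚ.≤? s) (All.replicate⁺ k μ≤m)
    ge-le≡le-ge : ge μ (le m V) ≡ le m (ge μ V)
    ge-le≡le-ge = filter-comm (λ s → μ ℚ.≤? s) (λ s → s ℚ.≤? m) V
    gt-ge≡gt : gt m (ge μ V) ≡ gt m V
    gt-ge≡gt = filter-filter-⊆ (λ s → m ℚ.<? s) (λ s → μ ℚ.≤? s)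
                 (λ m<s → ℚ.≤-trans μ≤m (ℚ.<⇒≤ m<s)) V

lemma4p33 : (E F Q : Bundle) → E ≢ [] → F ≢ [] → Q ≢ []
    → Conditions E F Q → Conditions E (reduction F Q) Q
lemma4p33 E F Q _ _ Q≢[] (i , ii , iii , (E-int , F-int , Q-int) , rkQ≡rkF) =
  i′ , ii , iii′ , (E-int , IntegerSlopes-reduction F Q m-int F-int , Q-int) ,
  trans rkQ≡rkF (sym (rk-reduction F Q m-int))
  where
  m = μmax Q
  m-int : IsIntegral m
  m-int = All.lookup Q-int (μmax-∈ Q Q≢[])

  i′ : ∀ μ → rk (le μ E) ℕ.≥ rk (le μ (reduction F Q))
  i′ μ with m ℚ.≤? μ
  ... | no m≰μ = ℕ.≤-trans (ℕ.≤-reflexive (cong rk (le-reduction F Q (ℚ.≰⇒> m≰μ)))) (i μ)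
  ... | yes m≤μ = begin
    rk (le μ (reduction F Q)) ≤⟨ rk-filter-≤ (λ s → s ℚ.≤? μ) (reduction F Q) ⟩
    rk (reduction F Q)        ≡⟨ rk-reduction F Q m-int ⟩
    rk F                      ≡⟨ rkQ≡rkF ⟨
    rk Q                      ≡⟨ cong rk (le-μmax Q m≤μ) ⟨
    rk (le μ Q)               ≤⟨ proj₁ (ii μ) ⟩
    rk (le μ E)               ∎
    where open ℕ.≤-Reasoning

  iii′ : ∀ μ → rk (ge μ (reduction F Q)) ℕ.≥ rk (ge μ Q)
  iii′ μ with μ ℚ.≤? m
  ... | yes μ≤m = ℕ.≤-trans (iii μ) (ℕ.≤-reflexive (sym (rk-ge-reduction F Q m-int μ≤m)))
  ... | no μ≰m rewrite ge-μmax Q (ℚ.≰⇒> μ≰m) = z≤n
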